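{- For each hereditarily sequential ground type $\gamma$ there is a polynomial $q_\gamma$ such that for every type-$\gamma$ value $v$, $\mathrm{ts}_\gamma(v)\le q_\gamma(\mathrm{size}(v))$.
   Context: Ground types are built from $\mathsf{unit}$ and inductive data types $\mu P$ ($P$ a polynomial functor built from $\mathrm{Id}$, constant functors, $+,\times$; $\mu P$ its nonempty least fixed point) by $+$ and $\times$. A ground type is hereditarily sequential iff every polynomial functor occurring within it has degree at most one. Values are value term graphs: rooted labelled dags with vertices labelled $\underline{()}$, $\underline\iota_j$ (one out-edge), pair (two out-edges) or $\underline{\mathsf c}_{\mu P}$ (one out-edge), with sharing allowed. Two values are bisimilar iff they have the same type and unfold to the same tree. $\mathrm{size}(v)$ is the number of $\underline{\mathsf c}_{\mu P}$-labelled vertices of $v$, and $\mathrm{ts}_\gamma(v)=\max\{\mathrm{size}(v')\mid v'\text{ bisimilar to }v\}$. -}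

module Defs where

open import Data.Nat using (ℕ; zero; suc; _+_; _*_; _≤_; _⊔_)
open import Data.Fin using (Fin)
open import Data.List using (List; []; _∷_; map; allFin)
open import Data.Nat.ListAction using (sum)
open import Data.Product using (Σ; _×_; _,_)
open import Data.Unit using (⊤)
open import Relation.Binary.PropositionalEquality using (_≡_)
open import Induction.WellFounded using (WellFounded)

data Ty : Set
data PF : Set

data Ty where
  unit : Ty
  μ    : PF → Ty
  _⊕_  : Ty → Ty → Ty
  _⊗_  : Ty → Ty → Ty

data PF where
  Id   : PF
  K    : Ty → PF
  _+ᶠ_ : PF → PF → PF
  _×ᶠ_ : PF → PF → PF

subst : PF → Ty → Ty
subst Id X = X
subst (K A) X = A
subst (P +ᶠ Q) X = subst P X ⊕ subst Q X
subst (P ×ᶠ Q) X = subst P X ⊗ subst Q X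

deg : PF → ℕ
deg Id = 1
deg (K A) = 0
deg (P +ᶠ Q) = deg P ⊔ deg Q
deg (P ×ᶠ Q) = deg P + deg Q

data Tree : Set where
  tunit : Tree
  tinl  : Tree → Tree
  tinr  : Tree → Tree
  tpair : Tree → Tree → Tree
  tcon  : PF → Tree → Tree

data TreeTy : Ty → Tree → Set where
  tyunit : TreeTy unit tunit
  tyinl  : ∀ {A B t} → TreeTy A t → TreeTy (A ⊕ B) (tinl t)
  tyinr  : ∀ {A B t} → TreeTy B t → TreeTy (A ⊕ B) (tinr t)
  typair : ∀ {A B s t} → TreeTy A s → TreeTy B t → TreeTy (A ⊗ B) (tpair s t)
  tycon  : ∀ {P t} → TreeTy (subst P (μ P)) t → TreeTy (μ P) (tcon P t)

WFTy : Ty → Set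
WFPF : PF → Set
WFTy unit = ⊤
WFTy (μ P) = WFPF P × Σ Tree (TreeTy (μ P))
WFTy (A ⊕ B) = WFTy A × WFTy B
WFTy (A ⊗ B) = WFTy A × WFTy B
WFPF Id = ⊤
WFPF (K A) = WFTy A
WFPF (P +ᶠ Q) = WFPF P × WFPF Q
WFPF (P ×ᶠ Q) = WFPF P × WFPF Q

HSTy  : Ty → Set
HSPF  : PF → Set
HSSub : PF → Set
HSTy unit = ⊤
HSTy (μ P) = HSPF P
HSTy (A ⊕ B) = HSTy A × HSTy B
HSTy (A ⊗ B) = HSTy A × HSTy B
HSPF P = deg P ≤ 1 × HSSub P
HSSub Id = ⊤
HSSub (K A) = HSTy A
HSSub (P +ᶠ Q) = HSPF P × HSPF Q
HSSub (P ×ᶠ Q) = HSPF P × HSPF Q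

data Node (n : ℕ) : Set where
  unitN : Node n
  inl   : Fin n → Node n
  inr   : Fin n → Node n
  pair  : Fin n → Fin n → Node n
  con   : PF → Fin n → Node n

data ChildOf {n : ℕ} (j : Fin n) : Node n → Set where
  c-inl   : ChildOf j (inl j)
  c-inr   : ChildOf j (inr j)
  c-pairˡ : ∀ {k} → ChildOf j (pair j k)
  c-pairʳ : ∀ {k} → ChildOf j (pair k j)
  c-con   : ∀ {P} → ChildOf j (con P j)

record Graph : Set where
  field
    n    : ℕ
    root : Fin n
    node : Fin n → Node n
    ty   : Fin n → Ty

open Graph public

-- Edge g j i : there is an edge from vertex i to vertex j
Edge : (g : Graph) → Fin (n g) → Fin (n g) → Set
Edge g j i = ChildOf j (node g i)

data Reach (g : Graph) : Fin (n g) → Fin (n g) → Set where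
  here : ∀ {i} → Reach g i i
  step : ∀ {i j k} → Reach g i j → Edge g k j → Reach g i k

data NodeOK {m : ℕ} (τ : Fin m → Ty) : Ty → Node m → Set where
  ok-unit : NodeOK τ unit unitN
  ok-inl  : ∀ {A B c} → τ c ≡ A → NodeOK τ (A ⊕ B) (inl c)
  ok-inr  : ∀ {A B c} → τ c ≡ B → NodeOK τ (A ⊕ B) (inr c)
  ok-pair : ∀ {A B a b} → τ a ≡ A → τ b ≡ B → NodeOK τ (A ⊗ B) (pair a b)
  ok-con  : ∀ {P c} → τ c ≡ subst P (μ P) → NodeOK τ (μ P) (con P c)

data Unfolds (g : Graph) : Fin (n g) → Tree → Set where
  u-unit : ∀ {i} → node g i ≡ unitN → Unfolds g i tunit
  u-inl  : ∀ {i c t} → node g i ≡ inl c → Unfolds g c t → Unfolds g i (tinl t)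
  u-inr  : ∀ {i c t} → node g i ≡ inr c → Unfolds g c t → Unfolds g i (tinr t)
  u-pair : ∀ {i a b s t} → node g i ≡ pair a b → Unfolds g a s → Unfolds g b t
         → Unfolds g i (tpair s t)
  u-con  : ∀ {i P c t} → node g i ≡ con P c → Unfolds g c t → Unfolds g i (tcon P t)

record Value (γ : Ty) : Set where
  field
    graph   : Graph
    typed   : ∀ i → NodeOK (ty graph) (ty graph i) (node graph i)
    acyclic : WellFounded (Edge graph)
    rooted  : ∀ i → Reach graph (root graph) i
    rootTy  : ty graph (root graph) ≡ γ

open Value public

Bisim : ∀ {γ δ} → Value γ → Value δ → Set
Bisim v w =
  (ty (graph v) (root (graph v)) ≡ ty (graph w) (root (graph w)))
  × Σ Tree (λ t → Unfolds (graph v) (root (graph v)) t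
                × Unfolds (graph w) (root (graph w)) t)

isCon : ∀ {m} → Node m → ℕ
isCon (con _ _) = 1
isCon _ = 0

size : ∀ {γ} → Value γ → ℕ
size v = sum (map (λ i → isCon (node (graph v) i)) (allFin (n (graph v))))

IsTs : (γ : Ty) → Value γ → ℕ → Set
IsTs γ v m =
  Σ (Value γ) (λ w → Bisim v w × size w ≡ m)
  × ((w : Value γ) → Bisim v w → size w ≤ m)

-- polynomials with natural-number coefficients (constant term first)

evalPoly : List ℕ → ℕ → ℕ
evalPoly [] x = 0
evalPoly (a ∷ as) x = a + x * evalPoly as x

{-# OPTIONS --safe #-}
-- A value v unfolds to a tree t, and ts(v) is the number of constructor
-- nodes of t: the sharing-free graph of t attains it, and every constructor
-- vertex of a value bisimilar to v is visited by that value's unfolding.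
-- A path in an acyclic graph meets each constructor vertex at most once, so
-- every branch of t crosses at most size(v) constructors. In a hereditarily
-- sequential type a tree of type μP (deg P ≤ 1) is a spine of constructors,
-- so a tree whose branches cross at most h constructors has at most q_γ(h)
-- constructor nodes, for a polynomial q_γ defined by recursion on γ.
module Submission where

open import Defs
open import Data.Bool using (Bool; true; false)
open import Data.Fin using (Fin; zero; suc; _↑ˡ_; _↑ʳ_; _≟_)
open import Data.Fin.Subset
  using (Subset; _∈_; _∉_; _⊆_; _∪_; _-_; ⁅_⁆; ∣_∣; inside; outside)
  renaming (⊥ to ∅)
open import Data.Fin.Subset.Properties
  using (_∈?_; ∣p∣≤∣x∷p∣; ∣⊥∣≡0; x∈⁅x⁆; ∣⁅x⁆∣≡1; p⊆q⇒∣p∣≤∣q∣; p⊆p∪q; q⊆p∪q;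
         x∈p∪q⁺; x∈p∧x≢y⇒x∈p-y; x∈p⇒∣p-x∣<∣p∣)
open import Data.List using (List; []; _∷_)
import Data.List as List
open import Data.List.Properties using (map-tabulate)
open import Data.Nat using (ℕ; zero; suc; _+_; _*_; _≤_; _⊔_; z≤n; s≤s)
open import Data.Nat.ListAction using (sum)
open import Data.Nat.Properties
  using (≤-reflexive; ≤-trans; module ≤-Reasoning; +-identityʳ; +-suc; *-zeroʳ;
         *-identityˡ; m≤m+n; m≤n+m; n≤1+n; +-mono-≤; +-monoʳ-≤; *-mono-≤; *-monoˡ-≤;
         *-monoʳ-≤; m≤m⊔n; m≤n⊔m; ⊔-lub; m⊔n≤o⇒m≤o; m⊔n≤o⇒n≤o)
open import Data.Nat.Tactic.RingSolver using (solve-∀)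
open import Data.Product using (Σ; ∃; _×_; _,_)
open import Data.Sum using (inj₁)
open import Data.Vec using ([]; _∷_; _++_; tabulate)
open import Data.Vec.Properties using (lookup∘tabulate; lookup⇒[]=; []=⇒lookup; tabulate-cong)
import Data.Vec.Functional as Vector
open import Data.Vec.Functional.Properties using (lookup-++ˡ; lookup-++ʳ)
open import Function using (_∘_; id)
open import Induction.WellFounded using (Acc; acc; WellFounded; acc⇒asym)
open import Relation.Binary.Construct.Closure.Transitive using (TransClosure; [_]; _∷_)
import Relation.Binary.Construct.Closure.Transitive as TransClosure
open import Relation.Binary.PropositionalEquality
  using (_≡_; refl; sym; trans; cong; cong₂; subst₂; module ≡-Reasoning)
import Relation.Binary.PropositionalEquality as ≡
open import Relation.Nullary using (¬_; yes; no; contradiction)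

-- Polynomials

infixl 6 _+ₚ_

_+ₚ_ : List ℕ → List ℕ → List ℕ
[] +ₚ q = q
(a ∷ p) +ₚ [] = a ∷ p
(a ∷ p) +ₚ (b ∷ q) = a + b ∷ p +ₚ q

evalPoly-+ₚ : ∀ p q x → evalPoly (p +ₚ q) x ≡ evalPoly p x + evalPoly q x
evalPoly-+ₚ [] q x = refl
evalPoly-+ₚ (a ∷ p) [] x = sym (+-identityʳ _)
evalPoly-+ₚ (a ∷ p) (b ∷ q) x =
  trans (cong (λ r → a + b + x * r) (evalPoly-+ₚ p q x))
        (interchange a b x (evalPoly p x) (evalPoly q x))
  where
  interchange : ∀ a b x u v → a + b + x * (u + v) ≡ a + x * u + (b + x * v)
  interchange = solve-∀

evalPoly-+ₚ-≤ˡ : ∀ p q x → evalPoly p x ≤ evalPoly (p +ₚ q) x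
evalPoly-+ₚ-≤ˡ p q x = ≤-trans (m≤m+n _ _) (≤-reflexive (sym (evalPoly-+ₚ p q x)))

evalPoly-+ₚ-≤ʳ : ∀ p q x → evalPoly q x ≤ evalPoly (p +ₚ q) x
evalPoly-+ₚ-≤ʳ p q x = ≤-trans (m≤n+m _ _) (≤-reflexive (sym (evalPoly-+ₚ p q x)))

evalPoly-monoʳ : ∀ p {x y} → x ≤ y → evalPoly p x ≤ evalPoly p y
evalPoly-monoʳ [] x≤y = z≤n
evalPoly-monoʳ (a ∷ p) x≤y = +-monoʳ-≤ a (*-mono-≤ x≤y (evalPoly-monoʳ p x≤y))

-- Typed trees

conCount : Tree → ℕ
conCount tunit = 0
conCount (tinl t) = conCount t
conCount (tinr t) = conCount t
conCount (tpair s t) = conCount s + conCount t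
conCount (tcon P t) = suc (conCount t)

conDepth : Tree → ℕ
conDepth tunit = 0
conDepth (tinl t) = conDepth t
conDepth (tinr t) = conDepth t
conDepth (tpair s t) = conDepth s ⊔ conDepth t
conDepth (tcon P t) = suc (conDepth t)

-- Since deg P ≤ 1, a tree of type μP of constructor depth h is a spine of
-- at most h constructors, each carrying data bounded by sizePolyᶠ P.
sizePoly : Ty → List ℕ
sizePolyᶠ : PF → List ℕ
sizePoly unit = []
sizePoly (μ P) = 0 ∷ (1 ∷ []) +ₚ sizePolyᶠ P
sizePoly (A ⊕ B) = sizePoly A +ₚ sizePoly B
sizePoly (A ⊗ B) = sizePoly A +ₚ sizePoly B
sizePolyᶠ Id = []
sizePolyᶠ (K A) = sizePoly A
sizePolyᶠ (P +ᶠ Q) = sizePolyᶠ P +ₚ sizePolyᶠ Q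
sizePolyᶠ (P ×ᶠ Q) = sizePolyᶠ P +ₚ sizePolyᶠ Q

evalPoly-sizePoly-μ : ∀ P x →
  evalPoly (sizePoly (μ P)) x ≡ x * suc (evalPoly (sizePolyᶠ P) x)
evalPoly-sizePoly-μ P x = cong (x *_) (begin
  evalPoly ((1 ∷ []) +ₚ L) x   ≡⟨ evalPoly-+ₚ (1 ∷ []) L x ⟩
  1 + x * 0 + evalPoly L x     ≡⟨ cong (λ r → suc (r + evalPoly L x)) (*-zeroʳ x) ⟩
  suc (evalPoly L x)           ∎)
  where
  open ≡-Reasoning
  L = sizePolyᶠ P

conCount-bound : ∀ {A t h} → TreeTy A t → HSTy A → conDepth t ≤ h →
  conCount t ≤ evalPoly (sizePoly A) h
conCount-boundᵘ : ∀ {P t} h → TreeTy (μ P) t → HSPF P → conDepth t ≤ h →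
  conCount t ≤ evalPoly (sizePoly (μ P)) h
conCount-boundᶠ : ∀ {P t h F} Q → TreeTy (subst Q (μ P)) t → HSSub Q →
  (∀ {u} → TreeTy (μ P) u → conDepth u ≤ h → conCount u ≤ F) →
  conDepth t ≤ h → conCount t ≤ evalPoly (sizePolyᶠ Q) h + deg Q * F

conCount-bound tyunit _ _ = z≤n
conCount-bound (tyinl {A} {B} d) (hA , _) t≤h =
  ≤-trans (conCount-bound d hA t≤h) (evalPoly-+ₚ-≤ˡ (sizePoly A) (sizePoly B) _)
conCount-bound (tyinr {A} {B} d) (_ , hB) t≤h =
  ≤-trans (conCount-bound d hB t≤h) (evalPoly-+ₚ-≤ʳ (sizePoly A) (sizePoly B) _)
conCount-bound (typair {A} {B} {s} {t} d e) (hA , hB) st≤h =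
  ≤-trans (+-mono-≤ (conCount-bound d hA (m⊔n≤o⇒m≤o (conDepth s) _ st≤h))
                    (conCount-bound e hB (m⊔n≤o⇒n≤o _ (conDepth t) st≤h)))
          (≤-reflexive (sym (evalPoly-+ₚ (sizePoly A) (sizePoly B) _)))
conCount-bound d@(tycon _) hP t≤h = conCount-boundᵘ _ d hP t≤h

conCount-boundᵘ {P} (suc h) (tycon {t = t} d) hP@(degP≤1 , hsub) (s≤s t≤h) = begin
  suc (conCount t)
    ≤⟨ s≤s (conCount-boundᶠ P d hsub (λ d′ → conCount-boundᵘ h d′ hP) t≤h) ⟩
  suc (L h + deg P * F)
    ≤⟨ s≤s (+-monoʳ-≤ (L h) (≤-trans (*-monoˡ-≤ F degP≤1) (≤-reflexive (*-identityˡ F)))) ⟩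
  suc (L h + F)
    ≡⟨ cong (λ r → suc (L h + r)) (evalPoly-sizePoly-μ P h) ⟩
  suc h * suc (L h)
    ≤⟨ *-monoʳ-≤ (suc h) (s≤s (evalPoly-monoʳ (sizePolyᶠ P) (n≤1+n h))) ⟩
  suc h * suc (L (suc h))
    ≡⟨ evalPoly-sizePoly-μ P (suc h) ⟨
  evalPoly (sizePoly (μ P)) (suc h) ∎
  where
  open ≤-Reasoning
  L = evalPoly (sizePolyᶠ P)
  F = evalPoly (sizePoly (μ P)) h

conCount-boundᶠ {F = F} Id d _ ih t≤h = ≤-trans (ih d t≤h) (m≤m+n F 0)
conCount-boundᶠ (K A) d hA _ t≤h = ≤-trans (conCount-bound d hA t≤h) (m≤m+n _ 0)
conCount-boundᶠ {h = h} {F} (Q₁ +ᶠ Q₂) (tyinl d) ((_ , h₁) , _) ih t≤h =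
  ≤-trans (conCount-boundᶠ Q₁ d h₁ ih t≤h)
          (+-mono-≤ (evalPoly-+ₚ-≤ˡ (sizePolyᶠ Q₁) _ h) (*-monoˡ-≤ F (m≤m⊔n (deg Q₁) (deg Q₂))))
conCount-boundᶠ {h = h} {F} (Q₁ +ᶠ Q₂) (tyinr d) (_ , (_ , h₂)) ih t≤h =
  ≤-trans (conCount-boundᶠ Q₂ d h₂ ih t≤h)
          (+-mono-≤ (evalPoly-+ₚ-≤ʳ (sizePolyᶠ Q₁) _ h) (*-monoˡ-≤ F (m≤n⊔m (deg Q₁) (deg Q₂))))
conCount-boundᶠ {h = h} {F} (Q₁ ×ᶠ Q₂) (typair {s = s} {t} d e) ((_ , h₁) , (_ , h₂)) ih st≤h =
  ≤-trans (+-mono-≤ (conCount-boundᶠ Q₁ d h₁ ih (m⊔n≤o⇒m≤o (conDepth s) _ st≤h))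
                    (conCount-boundᶠ Q₂ e h₂ ih (m⊔n≤o⇒n≤o _ (conDepth t) st≤h)))
          (≤-reflexive (trans (regroup L₁ L₂ (deg Q₁) (deg Q₂) F)
            (cong (_+ (deg Q₁ + deg Q₂) * F) (sym (evalPoly-+ₚ (sizePolyᶠ Q₁) (sizePolyᶠ Q₂) h)))))
  where
  L₁ = evalPoly (sizePolyᶠ Q₁) h
  L₂ = evalPoly (sizePolyᶠ Q₂) h
  regroup : ∀ a b x y f → a + x * f + (b + y * f) ≡ a + b + (x + y) * f
  regroup = solve-∀

-- Finite sets

∣p∪q∣≤∣p∣+∣q∣ : ∀ {m} (p q : Subset m) → ∣ p ∪ q ∣ ≤ ∣ p ∣ + ∣ q ∣
∣p∪q∣≤∣p∣+∣q∣ [] [] = z≤n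
∣p∪q∣≤∣p∣+∣q∣ (outside ∷ p) (outside ∷ q) = ∣p∪q∣≤∣p∣+∣q∣ p q
∣p∪q∣≤∣p∣+∣q∣ (outside ∷ p) (inside ∷ q) =
  ≤-trans (s≤s (∣p∪q∣≤∣p∣+∣q∣ p q)) (≤-reflexive (sym (+-suc ∣ p ∣ ∣ q ∣)))
∣p∪q∣≤∣p∣+∣q∣ (inside ∷ p) (x ∷ q) =
  s≤s (≤-trans (∣p∪q∣≤∣p∣+∣q∣ p q) (+-monoʳ-≤ ∣ p ∣ (∣p∣≤∣x∷p∣ x q)))

data Split (a b : ℕ) : Fin (a + b) → Set where
  left  : (i : Fin a) → Split a b (i ↑ˡ b)
  right : (j : Fin b) → Split a b (a ↑ʳ j)

split : ∀ a b k → Split a b k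
split zero b k = right k
split (suc a) b zero = left zero
split (suc a) b (suc k) with split a b k
... | left i = left (suc i)
... | right j = right j

tabulate-++ : ∀ {A : Set} a {b} (f : Fin (a + b) → A) →
  tabulate f ≡ tabulate (f ∘ (_↑ˡ b)) ++ tabulate (f ∘ (a ↑ʳ_))
tabulate-++ zero f = refl
tabulate-++ (suc a) f = cong (f zero ∷_) (tabulate-++ a (f ∘ suc))

∣p++q∣≡∣p∣+∣q∣ : ∀ {a b} (p : Subset a) (q : Subset b) → ∣ p ++ q ∣ ≡ ∣ p ∣ + ∣ q ∣
∣p++q∣≡∣p∣+∣q∣ [] q = refl
∣p++q∣≡∣p∣+∣q∣ (inside ∷ p) q = cong suc (∣p++q∣≡∣p∣+∣q∣ p q)
∣p++q∣≡∣p∣+∣q∣ (outside ∷ p) q = ∣p++q∣≡∣p∣+∣q∣ p q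

-- Constructor vertices of term graphs

isConᵇ : ∀ {m} → Node m → Bool
isConᵇ (con _ _) = true
isConᵇ _ = false

conSet : (g : Graph) → Subset (n g)
conSet g = tabulate (λ i → isConᵇ (node g i))

∣isConᵇ∷p∣ : ∀ {m k} (nd : Node m) (p : Subset k) → ∣ isConᵇ nd ∷ p ∣ ≡ isCon nd + ∣ p ∣
∣isConᵇ∷p∣ unitN p = refl
∣isConᵇ∷p∣ (inl _) p = refl
∣isConᵇ∷p∣ (inr _) p = refl
∣isConᵇ∷p∣ (pair _ _) p = refl
∣isConᵇ∷p∣ (con _ _) p = refl

∣tabulate-isConᵇ∣ : ∀ {m k} (ν : Fin m → Node k) →
  ∣ tabulate (isConᵇ ∘ ν) ∣ ≡ sum (List.tabulate (isCon ∘ ν))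
∣tabulate-isConᵇ∣ {zero} ν = refl
∣tabulate-isConᵇ∣ {suc m} ν =
  trans (∣isConᵇ∷p∣ (ν zero) (tabulate (isConᵇ ∘ ν ∘ suc)))
        (cong (isCon (ν zero) +_) (∣tabulate-isConᵇ∣ (ν ∘ suc)))

∣conSet∣≡size : ∀ {γ} (v : Value γ) → ∣ conSet (graph v) ∣ ≡ size v
∣conSet∣≡size v = trans (∣tabulate-isConᵇ∣ (node (graph v)))
  (cong sum (sym (map-tabulate id (λ i → isCon (node (graph v) i)))))

Typed : Graph → Set
Typed g = ∀ i → NodeOK (ty g) (ty g i) (node g i)

module _ {g : Graph} where

  edge : ∀ {i j nd} → node g i ≡ nd → ChildOf j nd → Edge g j i
  edge e ch = ≡.subst (ChildOf _) (sym e) ch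

  conSet⁺ : ∀ {i P c} → node g i ≡ con P c → i ∈ conSet g
  conSet⁺ {i} e = lookup⇒[]= i (conSet g) (trans (lookup∘tabulate _ i) (cong isConᵇ e))

  conSet⁻ : ∀ {i nd} → node g i ≡ nd → isConᵇ nd ≡ false → i ∉ conSet g
  conSet⁻ {i} e nd-not-con i∈ = contradiction
    (trans (sym ([]=⇒lookup i∈)) (trans (lookup∘tabulate _ i) (trans (cong isConᵇ e) nd-not-con)))
    λ ()

  unfold : ∀ {i} → Acc (Edge g) i → Σ Tree (Unfolds g i)
  unfold {i} (acc below) with node g i in e
  ... | unitN = tunit , u-unit e
  ... | inl c = let t , d = unfold (below c-inl) in tinl t , u-inl e d
  ... | inr c = let t , d = unfold (below c-inr) in tinr t , u-inr e d
  ... | con P c = let t , d = unfold (below c-con) in tcon P t , u-con e d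
  ... | pair a b =
    let s , d₁ = unfold (below c-pairˡ)
        t , d₂ = unfold (below c-pairʳ)
    in tpair s t , u-pair e d₁ d₂

  data UnfoldsAt : Node (n g) → Tree → Set where
    at-unit : UnfoldsAt unitN tunit
    at-inl  : ∀ {c t} → Unfolds g c t → UnfoldsAt (inl c) (tinl t)
    at-inr  : ∀ {c t} → Unfolds g c t → UnfoldsAt (inr c) (tinr t)
    at-pair : ∀ {a b s t} → Unfolds g a s → Unfolds g b t → UnfoldsAt (pair a b) (tpair s t)
    at-con  : ∀ {P c t} → Unfolds g c t → UnfoldsAt (con P c) (tcon P t)

  unfoldsAt : ∀ {i nd t} → node g i ≡ nd → Unfolds g i t → UnfoldsAt nd t
  unfoldsAt e d = ≡.subst (λ nd → UnfoldsAt nd _) e (view d)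
    where
    view : ∀ {i t} → Unfolds g i t → UnfoldsAt (node g i) t
    view (u-unit e) rewrite e = at-unit
    view (u-inl e d) rewrite e = at-inl d
    view (u-inr e d) rewrite e = at-inr d
    view (u-pair e d₁ d₂) rewrite e = at-pair d₁ d₂
    view (u-con e d) rewrite e = at-con d

  unfolds-deterministic : ∀ {i t t′} → Unfolds g i t → Unfolds g i t′ → t ≡ t′
  unfolds-deterministic (u-unit e) d′ with unfoldsAt e d′
  ... | at-unit = refl
  unfolds-deterministic (u-inl e d) d′ with unfoldsAt e d′
  ... | at-inl d″ = cong tinl (unfolds-deterministic d d″)
  unfolds-deterministic (u-inr e d) d′ with unfoldsAt e d′
  ... | at-inr d″ = cong tinr (unfolds-deterministic d d″)
  unfolds-deterministic (u-pair e d₁ d₂) d′ with unfoldsAt e d′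
  ... | at-pair d₁″ d₂″ = cong₂ tpair (unfolds-deterministic d₁ d₁″) (unfolds-deterministic d₂ d₂″)
  unfolds-deterministic (u-con e d) d′ with unfoldsAt e d′
  ... | at-con d″ = cong (tcon _) (unfolds-deterministic d d″)

  nodeOK : Typed g → ∀ {i A nd} → ty g i ≡ A → node g i ≡ nd → NodeOK (ty g) A nd
  nodeOK typed {i} i∶A e = subst₂ (NodeOK (ty g)) i∶A e (typed i)

  unfolds-typed : Typed g → ∀ {i t A} → ty g i ≡ A → Unfolds g i t → TreeTy A t
  unfolds-typed typed i∶A (u-unit e) with nodeOK typed i∶A e
  ... | ok-unit = tyunit
  unfolds-typed typed i∶A (u-inl e d) with nodeOK typed i∶A e
  ... | ok-inl c∶A = tyinl (unfolds-typed typed c∶A d)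
  unfolds-typed typed i∶A (u-inr e d) with nodeOK typed i∶A e
  ... | ok-inr c∶B = tyinr (unfolds-typed typed c∶B d)
  unfolds-typed typed i∶A (u-pair e d₁ d₂) with nodeOK typed i∶A e
  ... | ok-pair a∶A b∶B = typair (unfolds-typed typed a∶A d₁) (unfolds-typed typed b∶B d₂)
  unfolds-typed typed i∶A (u-con e d) with nodeOK typed i∶A e
  ... | ok-con c∶F = tycon (unfolds-typed typed c∶F d)

  acyclic⇒irreflexive : WellFounded (Edge g) → ∀ {i} → ¬ TransClosure (Edge g) i i
  acyclic⇒irreflexive wf {i} i⁺i = acc⇒asym (TransClosure.accessible (Edge g) (wf i)) i⁺i i⁺i

  -- Every constructor vertex outside avail lies strictly above i; by
  -- acyclicity a constructor vertex met further down is therefore still in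
  -- avail, and passing it removes it from avail.
  conDepth-bound : WellFounded (Edge g) → ∀ {i t} (avail : Subset (n g)) →
    (∀ {j} → j ∈ conSet g → j ∉ avail → TransClosure (Edge g) i j) →
    Unfolds g i t → conDepth t ≤ ∣ avail ∣
  conDepth-bound wf avail above (u-unit e) = z≤n
  conDepth-bound wf avail above (u-inl e d) =
    conDepth-bound wf avail (λ j∈ j∉ → edge e c-inl ∷ above j∈ j∉) d
  conDepth-bound wf avail above (u-inr e d) =
    conDepth-bound wf avail (λ j∈ j∉ → edge e c-inr ∷ above j∈ j∉) d
  conDepth-bound wf avail above (u-pair e d₁ d₂) = ⊔-lub
    (conDepth-bound wf avail (λ j∈ j∉ → edge e c-pairˡ ∷ above j∈ j∉) d₁)
    (conDepth-bound wf avail (λ j∈ j∉ → edge e c-pairʳ ∷ above j∈ j∉) d₂)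
  conDepth-bound wf avail above (u-con {i} e d) with i ∈? avail
  ... | no i∉ = contradiction (above (conSet⁺ e) i∉) (acyclic⇒irreflexive wf)
  ... | yes i∈ = ≤-trans (s≤s (conDepth-bound wf (avail - i) above′ d)) (x∈p⇒∣p-x∣<∣p∣ i∈)
    where
    above′ : ∀ {j} → j ∈ conSet g → j ∉ avail - i → TransClosure (Edge g) _ j
    above′ {j} j∈ j∉ with j ≟ i
    ... | yes refl = [ edge e c-con ]
    ... | no j≢i = edge e c-con ∷ above j∈ (λ j∈avail → j∉ (x∈p∧x≢y⇒x∈p-y j∈avail j≢i))

  conDepth≤∣conSet∣ : WellFounded (Edge g) → ∀ {i t} → Unfolds g i t → conDepth t ≤ ∣ conSet g ∣
  conDepth≤∣conSet∣ wf = conDepth-bound wf (conSet g) (λ j∈ j∉ → contradiction j∈ j∉)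

  conVertices : ∀ {i t} → Unfolds g i t → Subset (n g)
  conVertices (u-unit _) = ∅
  conVertices (u-inl _ d) = conVertices d
  conVertices (u-inr _ d) = conVertices d
  conVertices (u-pair _ d₁ d₂) = conVertices d₁ ∪ conVertices d₂
  conVertices (u-con {i} _ d) = ⁅ i ⁆ ∪ conVertices d

  ∣conVertices∣≤conCount : ∀ {i t} (d : Unfolds g i t) → ∣ conVertices d ∣ ≤ conCount t
  ∣conVertices∣≤conCount (u-unit _) = ≤-reflexive (∣⊥∣≡0 (n g))
  ∣conVertices∣≤conCount (u-inl _ d) = ∣conVertices∣≤conCount d
  ∣conVertices∣≤conCount (u-inr _ d) = ∣conVertices∣≤conCount d
  ∣conVertices∣≤conCount (u-pair _ d₁ d₂) =
    ≤-trans (∣p∪q∣≤∣p∣+∣q∣ (conVertices d₁) (conVertices d₂))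
      (+-mono-≤ (∣conVertices∣≤conCount d₁) (∣conVertices∣≤conCount d₂))
  ∣conVertices∣≤conCount (u-con {i} _ d) =
    ≤-trans (∣p∪q∣≤∣p∣+∣q∣ ⁅ i ⁆ (conVertices d))
      (≤-trans (≤-reflexive (cong (_+ ∣ conVertices d ∣) (∣⁅x⁆∣≡1 i)))
               (s≤s (∣conVertices∣≤conCount d)))

  ∈conVertices : ∀ {j t} → j ∈ conSet g → (d : Unfolds g j t) → j ∈ conVertices d
  ∈conVertices j∈ (u-unit e) = contradiction j∈ (conSet⁻ e refl)
  ∈conVertices j∈ (u-inl e _) = contradiction j∈ (conSet⁻ e refl)
  ∈conVertices j∈ (u-inr e _) = contradiction j∈ (conSet⁻ e refl)
  ∈conVertices j∈ (u-pair e _ _) = contradiction j∈ (conSet⁻ e refl)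
  ∈conVertices {j} j∈ (u-con e _) = x∈p∪q⁺ (inj₁ (x∈⁅x⁆ j))

  SubUnfolding : ∀ {i t} → Unfolds g i t → Fin (n g) → Set
  SubUnfolding d j = Σ Tree λ t′ → Σ (Unfolds g j t′) λ d′ → conVertices d′ ⊆ conVertices d

  unfolds-child : ∀ {i j t} (d : Unfolds g i t) → Edge g j i → SubUnfolding d j
  unfolds-child (u-unit e) j<i with ≡.subst (ChildOf _) e j<i
  ... | ()
  unfolds-child (u-inl e d) j<i with ≡.subst (ChildOf _) e j<i
  ... | c-inl = _ , d , id
  unfolds-child (u-inr e d) j<i with ≡.subst (ChildOf _) e j<i
  ... | c-inr = _ , d , id
  unfolds-child (u-pair e d₁ d₂) j<i with ≡.subst (ChildOf _) e j<i
  ... | c-pairˡ = _ , d₁ , p⊆p∪q (conVertices d₂)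
  ... | c-pairʳ = _ , d₂ , q⊆p∪q (conVertices d₁) (conVertices d₂)
  unfolds-child (u-con {i} e d) j<i with ≡.subst (ChildOf _) e j<i
  ... | c-con = _ , d , q⊆p∪q ⁅ i ⁆ (conVertices d)

  unfolds-reach : ∀ {i j t} (d : Unfolds g i t) → Reach g i j → SubUnfolding d j
  unfolds-reach d here = _ , d , id
  unfolds-reach d (step i⇝j k<j) =
    let _ , d′ , d′⊆d = unfolds-reach d i⇝j
        _ , d″ , d″⊆d′ = unfolds-child d′ k<j
    in _ , d″ , d′⊆d ∘ d″⊆d′

size≤conCount : ∀ {γ t} (w : Value γ) → Unfolds (graph w) (root (graph w)) t → size w ≤ conCount t
size≤conCount {t = t} w d = begin
  size w                   ≡⟨ ∣conSet∣≡size w ⟨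
  ∣ conSet (graph w) ∣      ≤⟨ p⊆q⇒∣p∣≤∣q∣ conSet⊆conVertices ⟩
  ∣ conVertices d ∣         ≤⟨ ∣conVertices∣≤conCount d ⟩
  conCount t               ∎
  where
  open ≤-Reasoning
  conSet⊆conVertices : conSet (graph w) ⊆ conVertices d
  conSet⊆conVertices {j} j∈ =
    let _ , d′ , d′⊆d = unfolds-reach d (rooted w j) in d′⊆d (∈conVertices j∈ d′)

-- Unshared values

mapNode : ∀ {m k} → (Fin m → Fin k) → Node m → Node k
mapNode f unitN = unitN
mapNode f (inl c) = inl (f c)
mapNode f (inr c) = inr (f c)
mapNode f (pair a b) = pair (f a) (f b)
mapNode f (con P c) = con P (f c)

isConᵇ-mapNode : ∀ {m k} (f : Fin m → Fin k) nd → isConᵇ (mapNode f nd) ≡ isConᵇ nd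
isConᵇ-mapNode f unitN = refl
isConᵇ-mapNode f (inl _) = refl
isConᵇ-mapNode f (inr _) = refl
isConᵇ-mapNode f (pair _ _) = refl
isConᵇ-mapNode f (con _ _) = refl

ChildOf-mapNode⁺ : ∀ {m k} (f : Fin m → Fin k) {j nd} → ChildOf j nd → ChildOf (f j) (mapNode f nd)
ChildOf-mapNode⁺ f c-inl = c-inl
ChildOf-mapNode⁺ f c-inr = c-inr
ChildOf-mapNode⁺ f c-pairˡ = c-pairˡ
ChildOf-mapNode⁺ f c-pairʳ = c-pairʳ
ChildOf-mapNode⁺ f c-con = c-con

ChildOf-mapNode⁻ : ∀ {m k} (f : Fin m → Fin k) {j} nd → ChildOf j (mapNode f nd) →
  ∃ λ i → j ≡ f i × ChildOf i nd
ChildOf-mapNode⁻ f (inl c) c-inl = c , refl , c-inl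
ChildOf-mapNode⁻ f (inr c) c-inr = c , refl , c-inr
ChildOf-mapNode⁻ f (pair a b) c-pairˡ = a , refl , c-pairˡ
ChildOf-mapNode⁻ f (pair a b) c-pairʳ = b , refl , c-pairʳ
ChildOf-mapNode⁻ f (con P c) c-con = c , refl , c-con

prepend : ∀ {g i j k} → Edge g j i → Reach g j k → Reach g i k
prepend j<i here = step here j<i
prepend j<i (step j⇝k l<k) = step (prepend j<i j⇝k) l<k

module Embedding {g g′ : Graph} (f : Fin (n g) → Fin (n g′))
  (node-f : ∀ i → node g′ (f i) ≡ mapNode f (node g i))
  (ty-f : ∀ i → ty g′ (f i) ≡ ty g i) where

  edge⁺ : ∀ {i j} → Edge g j i → Edge g′ (f j) (f i)
  edge⁺ {i} j<i = ≡.subst (ChildOf _) (sym (node-f i)) (ChildOf-mapNode⁺ f j<i)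

  reach⁺ : ∀ {i j} → Reach g i j → Reach g′ (f i) (f j)
  reach⁺ here = here
  reach⁺ (step i⇝j k<j) = step (reach⁺ i⇝j) (edge⁺ k<j)

  acc⁺ : ∀ {i} → Acc (Edge g) i → Acc (Edge g′) (f i)
  acc⁺ {i} (acc below) = acc λ {k} k<fi →
    let j , k≡fj , j<i = ChildOf-mapNode⁻ f (node g i) (≡.subst (ChildOf k) (node-f i) k<fi)
    in ≡.subst (Acc (Edge g′)) (sym k≡fj) (acc⁺ (below j<i))

  unfolds⁺ : ∀ {i t} → Unfolds g i t → Unfolds g′ (f i) t
  unfolds⁺ {i} (u-unit e) = u-unit (trans (node-f i) (cong (mapNode f) e))
  unfolds⁺ {i} (u-inl e d) = u-inl (trans (node-f i) (cong (mapNode f) e)) (unfolds⁺ d)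
  unfolds⁺ {i} (u-inr e d) = u-inr (trans (node-f i) (cong (mapNode f) e)) (unfolds⁺ d)
  unfolds⁺ {i} (u-pair e d₁ d₂) =
    u-pair (trans (node-f i) (cong (mapNode f) e)) (unfolds⁺ d₁) (unfolds⁺ d₂)
  unfolds⁺ {i} (u-con e d) = u-con (trans (node-f i) (cong (mapNode f) e)) (unfolds⁺ d)

  nodeOK⁺ : ∀ {A nd} → NodeOK (ty g) A nd → NodeOK (ty g′) A (mapNode f nd)
  nodeOK⁺ ok-unit = ok-unit
  nodeOK⁺ (ok-inl {c = c} c∶A) = ok-inl (trans (ty-f c) c∶A)
  nodeOK⁺ (ok-inr {c = c} c∶B) = ok-inr (trans (ty-f c) c∶B)
  nodeOK⁺ (ok-pair {a = a} {b} a∶A b∶B) = ok-pair (trans (ty-f a) a∶A) (trans (ty-f b) b∶B)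
  nodeOK⁺ (ok-con {c = c} c∶F) = ok-con (trans (ty-f c) c∶F)

  typed⁺ : Typed g → ∀ i → NodeOK (ty g′) (ty g′ (f i)) (node g′ (f i))
  typed⁺ typed i rewrite node-f i | ty-f i = nodeOK⁺ (typed i)

  isConᵇ⁺ : ∀ i → isConᵇ (node g′ (f i)) ≡ isConᵇ (node g i)
  isConᵇ⁺ i = trans (cong isConᵇ (node-f i)) (isConᵇ-mapNode f (node g i))

extend : (g : Graph) → Node (n g) → Ty → Graph
extend g top A = record
  { n = suc (n g)
  ; root = zero
  ; node = mapNode suc top Vector.∷ (mapNode suc ∘ node g)
  ; ty = A Vector.∷ ty g
  }

module _ (g : Graph) (top : Node (n g)) (A : Ty) where
  open Embedding {g} {extend g top A} suc (λ _ → refl) (λ _ → refl)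

  typed-extend : Typed g → NodeOK (ty g) A top → Typed (extend g top A)
  typed-extend typed top∶A zero = nodeOK⁺ top∶A
  typed-extend typed top∶A (suc i) = typed⁺ typed i

  acyclic-extend : WellFounded (Edge g) → WellFounded (Edge (extend g top A))
  acyclic-extend wf zero = acc below
    where
    below : ∀ {k} → ChildOf k (mapNode suc top) → Acc (Edge (extend g top A)) k
    below k<top with ChildOf-mapNode⁻ suc top k<top
    ... | j , refl , _ = acc⁺ (wf j)
  acyclic-extend wf (suc i) = acc⁺ (wf i)

  rooted-extend : (∀ i → ∃ λ j → ChildOf j top × Reach g j i) → ∀ i → Reach (extend g top A) zero i
  rooted-extend covered zero = here
  rooted-extend covered (suc i) =
    let j , j<top , j⇝i = covered i in prepend (ChildOf-mapNode⁺ suc j<top) (reach⁺ j⇝i)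

  unfolds-extend : ∀ {i t} → Unfolds g i t → Unfolds (extend g top A) (suc i) t
  unfolds-extend = unfolds⁺

  conSet-extend : conSet (extend g top A) ≡ isConᵇ top ∷ conSet g
  conSet-extend = cong₂ _∷_ (isConᵇ-mapNode suc top) (tabulate-cong isConᵇ⁺)

-- The root of a disjoint union is a junk value: unions only occur under extend.
_⊎ᴳ_ : Graph → Graph → Graph
gl ⊎ᴳ gr = record
  { n = n gl + n gr
  ; root = root gl ↑ˡ n gr
  ; node = (mapNode (_↑ˡ n gr) ∘ node gl) Vector.++ (mapNode (n gl ↑ʳ_) ∘ node gr)
  ; ty = ty gl Vector.++ ty gr
  }

module _ (gl gr : Graph) where
  private
    module L = Embedding {gl} {gl ⊎ᴳ gr} (_↑ˡ n gr) (lookup-++ˡ _ _) (lookup-++ˡ _ _)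
    module R = Embedding {gr} {gl ⊎ᴳ gr} (n gl ↑ʳ_)
      (lookup-++ʳ (mapNode (_↑ˡ n gr) ∘ node gl) _) (lookup-++ʳ (ty gl) _)

  open L public using () renaming (unfolds⁺ to unfolds-⊎ˡ; reach⁺ to reach-⊎ˡ)
  open R public using () renaming (unfolds⁺ to unfolds-⊎ʳ; reach⁺ to reach-⊎ʳ)

  typed-⊎ : Typed gl → Typed gr → Typed (gl ⊎ᴳ gr)
  typed-⊎ typedˡ typedʳ k with split (n gl) (n gr) k
  ... | left i = L.typed⁺ typedˡ i
  ... | right j = R.typed⁺ typedʳ j

  acyclic-⊎ : WellFounded (Edge gl) → WellFounded (Edge gr) → WellFounded (Edge (gl ⊎ᴳ gr))
  acyclic-⊎ wfˡ wfʳ k with split (n gl) (n gr) k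
  ... | left i = L.acc⁺ (wfˡ i)
  ... | right j = R.acc⁺ (wfʳ j)

  ∣conSet-⊎∣ : ∣ conSet (gl ⊎ᴳ gr) ∣ ≡ ∣ conSet gl ∣ + ∣ conSet gr ∣
  ∣conSet-⊎∣ = trans (cong ∣_∣ conSet-⊎) (∣p++q∣≡∣p∣+∣q∣ (conSet gl) (conSet gr))
    where
    conSet-⊎ : conSet (gl ⊎ᴳ gr) ≡ conSet gl ++ conSet gr
    conSet-⊎ = trans (tabulate-++ (n gl) _)
                     (cong₂ _++_ (tabulate-cong L.isConᵇ⁺) (tabulate-cong R.isConᵇ⁺))

extendValue : ∀ {T} (g : Graph) → Typed g → WellFounded (Edge g) →
  (top : Node (n g)) → NodeOK (ty g) T top → (∀ i → ∃ λ j → ChildOf j top × Reach g j i) → Value T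
extendValue {T} g typed wf top top∶T covered = record
  { graph = extend g top T
  ; typed = typed-extend g top T typed top∶T
  ; acyclic = acyclic-extend g top T wf
  ; rooted = rooted-extend g top T covered
  ; rootTy = refl
  }

underValue : ∀ {A T} (w : Value A) (top : Node (n (graph w))) →
  NodeOK (ty (graph w)) T top → ChildOf (root (graph w)) top → Value T
underValue w top top∶T r<top =
  extendValue (graph w) (typed w) (acyclic w) top top∶T (λ i → _ , r<top , rooted w i)

pairValue : ∀ {A B} → Value A → Value B → Value (A ⊗ B)
pairValue wl wr = extendValue (gl ⊎ᴳ gr) (typed-⊎ gl gr (typed wl) (typed wr))
  (acyclic-⊎ gl gr (acyclic wl) (acyclic wr)) (pair (root gl ↑ˡ n gr) (n gl ↑ʳ root gr))
  (ok-pair (trans (lookup-++ˡ (ty gl) (ty gr) (root gl)) (rootTy wl))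
           (trans (lookup-++ʳ (ty gl) (ty gr) (root gr)) (rootTy wr)))
  covered
  where
  gl = graph wl
  gr = graph wr
  covered : ∀ k → ∃ λ j →
    ChildOf j (pair (root gl ↑ˡ n gr) (n gl ↑ʳ root gr)) × Reach (gl ⊎ᴳ gr) j k
  covered k with split (n gl) (n gr) k
  ... | left i = _ , c-pairˡ , reach-⊎ˡ gl gr (rooted wl i)
  ... | right j = _ , c-pairʳ , reach-⊎ʳ gl gr (rooted wr j)

unitValue : Value unit
unitValue = record
  { graph = record { n = 1 ; root = zero ; node = λ _ → unitN ; ty = λ _ → unit }
  ; typed = λ { zero → ok-unit }
  ; acyclic = λ { zero → acc λ () }
  ; rooted = λ { zero → here }
  ; rootTy = refl
  }

Unshared : (A : Ty) → Tree → Set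
Unshared A t =
  Σ (Value A) λ w → Unfolds (graph w) (root (graph w)) t × ∣ conSet (graph w) ∣ ≡ conCount t

unshared : ∀ {A t} → TreeTy A t → Unshared A t
unshared tyunit = unitValue , u-unit refl , refl
unshared (tyinl {A} {B} d) with unshared d
... | w , u , s = underValue w top (ok-inl (rootTy w)) c-inl
                , u-inl refl (unfolds-extend g top (A ⊕ B) u)
                , trans (cong ∣_∣ (conSet-extend g top (A ⊕ B))) s
  where g = graph w
        top = inl (root g)
unshared (tyinr {A} {B} d) with unshared d
... | w , u , s = underValue w top (ok-inr (rootTy w)) c-inr
                , u-inr refl (unfolds-extend g top (A ⊕ B) u)
                , trans (cong ∣_∣ (conSet-extend g top (A ⊕ B))) s
  where g = graph w
        top = inr (root g)
unshared (tycon {P} d) with unshared d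
... | w , u , s = underValue w top (ok-con (rootTy w)) c-con
                , u-con refl (unfolds-extend g top (μ P) u)
                , trans (cong ∣_∣ (conSet-extend g top (μ P))) (cong suc s)
  where g = graph w
        top = con P (root g)
unshared (typair {A} {B} d₁ d₂) with unshared d₁ | unshared d₂
... | wl , ul , sl | wr , ur , sr = pairValue wl wr
    , u-pair refl (unfolds-extend g top (A ⊗ B) (unfolds-⊎ˡ gl gr ul))
                  (unfolds-extend g top (A ⊗ B) (unfolds-⊎ʳ gl gr ur))
    , trans (cong ∣_∣ (conSet-extend g top (A ⊗ B))) (trans (∣conSet-⊎∣ gl gr) (cong₂ _+_ sl sr))
  where gl = graph wl
        gr = graph wr
        g = gl ⊎ᴳ gr
        top = pair (root gl ↑ˡ n gr) (n gl ↑ʳ root gr)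

-- Tree size

isTs-conCount : ∀ {γ t} (v : Value γ) → Unfolds (graph v) (root (graph v)) t → IsTs γ v (conCount t)
isTs-conCount {t = t} v d with unshared (unfolds-typed (typed v) (rootTy v) d)
... | w , u , s =
  (w , (trans (rootTy v) (sym (rootTy w)) , t , d , u) , trans (sym (∣conSet∣≡size w)) s) , maximal
  where
  maximal : (w′ : Value _) → Bisim v w′ → size w′ ≤ conCount t
  maximal w′ (_ , t′ , d′ , u′) =
    ≡.subst (λ t″ → size w′ ≤ conCount t″) (unfolds-deterministic d′ d) (size≤conCount w′ u′)

conDepth≤size : ∀ {γ t} (v : Value γ) → Unfolds (graph v) (root (graph v)) t → conDepth t ≤ size v
conDepth≤size v d = ≤-trans (conDepth≤∣conSet∣ (acyclic v) d) (≤-reflexive (∣conSet∣≡size v))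

corollary13 : (γ : Ty) → WFTy γ → HSTy γ →
    Σ (List ℕ) (λ q → (v : Value γ) →
      Σ ℕ (λ m → IsTs γ v m × m ≤ evalPoly q (size v)))
corollary13 γ _ hs = sizePoly γ , bound
  where
  bound : (v : Value γ) → Σ ℕ (λ m → IsTs γ v m × m ≤ evalPoly (sizePoly γ) (size v))
  bound v with unfold (acyclic v (root (graph v)))
  ... | t , d = conCount t , isTs-conCount v d
              , conCount-bound (unfolds-typed (typed v) (rootTy v) d) hs (conDepth≤size v d)
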